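{- Let $p\ge5$ be a prime, $n\ge1$, $G = \langle e_1\rangle\oplus\langle e_2\rangle$ with $\operatorname{ord}(e_1)=p$, $\operatorname{ord}(e_2)=pn$, $K$ a splitting field of $G$, $\zeta\in K$ a primitive $pn$-th root of unity, and $\psi,\varphi\in\widehat G$ defined by $\psi(e_1)=\zeta^n$, $\psi(e_2)=1$, $\varphi(e_1)=1$, $\varphi(e_2)=\zeta$. Let $k_1,k_2,k_3\in[0,p-1]$ be pairwise distinct, $l\in[2,p-1]$, $\chi\in\widehat G$, and $\chi_{i,j}\in\widehat G$ for $i\in[1,3]$, $j\in[1,l]$. Then \[ \Big|\Big(\bigcup_{i=1}^3\bigcup_{j=1}^l\chi_{i,j}\langle k_ie_1+e_2\rangle^\perp\Big)\cap\chi\langle\psi,\varphi^n\rangle\Big| < l(3p-2l). \]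
   Context: $[a,b]=\{x\in\mathbb Z: a\le x\le b\}$. A field $K$ is a splitting field of $G$ if the group of $\exp(G)$-th roots of unity in $K$ has exactly $\exp(G)$ elements. $\widehat G=\operatorname{Hom}(G,K^\times)$. For a subgroup $U\subset G$, $U^\perp=\{\chi\in\widehat G:\chi(u)=1\ \forall u\in U\}$ and $\chi U^\perp$ is the coset of $U^\perp$ containing $\chi$; $\chi\langle\psi,\varphi^n\rangle$ is the coset of the subgroup generated by $\psi$ and $\varphi^n$ containing $\chi$. -}

module Defs where

open import Data.Nat using (ℕ; zero; suc; _+_; _*_; NonZero)
open import Data.Nat.Properties using (m*n≢0)
open import Data.Nat.DivMod using (_mod_)
open import Data.Fin using (Fin; toℕ)
open import Data.Product using (_×_; _,_; ∃; ∃-syntax)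
open import Relation.Binary.PropositionalEquality using (_≡_)

module Grp (p n : ℕ) .{{_ : NonZero p}} .{{_ : NonZero n}} where

  instance
    pn≢0 : NonZero (p * n)
    pn≢0 = m*n≢0 p n

  -- an element (x , y) of G stands for x e₁ + y e₂
  G : Set
  G = Fin p × Fin (p * n)

  _·G_ : ℕ → G → G
  m ·G (x , y) = ((m * toℕ x) mod p) , ((m * toℕ y) mod (p * n))

  ke₁+e₂ : Fin p → G
  ke₁+e₂ k = (toℕ k mod p) , (1 mod (p * n))

  ⟨_⟩ : G → G → Set
  ⟨ g ⟩ u = ∃[ m ] (u ≡ m ·G g)

  -- A character χ ∈ Ĝ is written (a , b), meaning χ = ψ^a φ^b, where
  -- ψ(e₁) = ζ^n, ψ(e₂) = 1, φ(e₁) = 1, φ(e₂) = ζ, ζ a primitive pn-th root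
  -- of unity in the splitting field K.  Values are recorded as exponents of ζ:
  -- χ(g) = ζ^(ev χ g).
  Ĝ : Set
  Ĝ = Fin p × Fin (p * n)

  ev : Ĝ → G → Fin (p * n)
  ev (a , b) (x , y) = (n * toℕ a * toℕ x + toℕ b * toℕ y) mod (p * n)

  𝟙 : Ĝ
  𝟙 = (0 mod p) , (0 mod (p * n))

  _⊙_ : Ĝ → Ĝ → Ĝ
  (a , b) ⊙ (a' , b') = ((toℕ a + toℕ a') mod p) , ((toℕ b + toℕ b') mod (p * n))

  _^_ : Ĝ → ℕ → Ĝ
  χ ^ zero = 𝟙
  χ ^ suc k = χ ⊙ (χ ^ k)

  ψ : Ĝ
  ψ = (1 mod p) , (0 mod (p * n))

  φ : Ĝ
  φ = (0 mod p) , (1 mod (p * n))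

  _⊥ : (G → Set) → Ĝ → Set
  (U ⊥) θ = ∀ u → U u → ev θ u ≡ 0 mod (p * n)

  ⟨ψ,φⁿ⟩ : Ĝ → Set
  ⟨ψ,φⁿ⟩ θ = ∃[ s ] ∃[ t ] (θ ≡ (ψ ^ s) ⊙ ((φ ^ n) ^ t))

  coset : Ĝ → (Ĝ → Set) → Ĝ → Set
  coset χ H θ = ∃[ h ] (H h × θ ≡ χ ⊙ h)

module Submission where

-- Sending ψ^a φ^b to (a , b / n) identifies the coset χ⟨ψ,φⁿ⟩ with the grid 𝔽_p², since b mod n is
-- constant on the coset, and χ_{i,j}⟨k_i e₁ + e₂⟩^⊥ meets it in the line c + k_i a ≡ const. So we
-- bound the number of points on s_i ≤ l chosen lines from each of three parallel classes i with
-- distinct slopes. If p < 2l the grid bound p² < l(3p - 2l) suffices, and p = 2l is excluded by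
-- primality. Otherwise record a point by its class-0 line together with its abscissa if that line is
-- chosen, else with a chosen line of class 1 or 2 through it; there are at most
-- s₀ p + (p - s₀)(s₁ + s₂) ≤ l(3p - 2l) records, with equality only if s₀ = s₁ = s₂ = l. In that case
-- some point lies on chosen lines of classes 1 and 2 but on none of class 0, so its class-2 record is
-- never used: otherwise, for two chosen class-2 lines, the set of chosen class-0 lines would be
-- invariant under a nonzero translation of 𝔽_p, forcing s₀ = p.

open import Defs
open import Data.Nat using (ℕ; _*_; _∸_; _≤_; _<_; NonZero; z≤n; s≤s)
open import Data.Nat.Properties using (≤-trans; ≤-reflexive)
open import Data.Nat.DivMod using (_/_)
open import Data.Nat.Primality using (Prime)
open import Data.Fin using (Fin; toℕ)
open import Data.List using (List; length; map; tabulate)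
open import Data.List.Properties using (length-map; length-tabulate)
open import Data.List.Relation.Unary.All as All using (All)
open import Data.List.Relation.Unary.All.Properties using (map⁺)
open import Data.List.Relation.Unary.Unique.Propositional using (Unique)
open import Data.List.Membership.Propositional using (_∈_)
open import Data.List.Membership.Propositional.Properties using (∈-tabulate⁺)
open import Data.Product using (_×_; ∃-syntax; _,_; proj₂)
open import Function.Definitions using (Injective)
open import Relation.Binary.PropositionalEquality using (_≡_; subst; sym; trans; cong)

module Congruence (m : ℕ) where

  open import Data.Nat as ℕ using (suc)
  open import Data.Nat.DivMod using (_%_; _/_; m≡m%n+[m/n]*n; [m+kn]%n≡m%n; m<n⇒m%n≡m)
  open import Data.Nat.Primality using (euclidsLemma)
  import Data.Nat.Divisibility as ℕ
  open import Data.Integer using (ℤ; +_; -[1+_]; 0ℤ; _+_; _-_; -_; ∣_∣) renaming (_*_ to _·_)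
  open import Data.Integer.Properties using (pos-+; pos-*; abs-*; +-injective; +-identityˡ; ⊖-≥; m-n≡m⊖n)
  open import Data.Integer.Divisibility.Signed using (_∣_; divides; ∣⇒∣ᵤ; ∣ᵤ⇒∣)
  open import Data.Integer.Tactic.RingSolver using (solve-∀)
  open import Data.Sum using (_⊎_; inj₁; inj₂)
  open import Relation.Binary.Structures using (IsEquivalence)
  open import Relation.Binary.Bundles using (Setoid)
  open import Level using (0ℓ)
  import Relation.Binary.Reasoning.Setoid
  open import Relation.Binary.PropositionalEquality

  infix 4 _≈_
  record _≈_ (x y : ℤ) : Set where
    constructor congruent
    field
      quotient : ℤ
      equation : x ≡ y + quotient · + m

  ≈-reflexive : ∀ {x y} → x ≡ y → x ≈ y
  ≈-reflexive {x} refl = congruent 0ℤ (lemma x (+ m))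
    where lemma : ∀ x m → x ≡ x + 0ℤ · m
          lemma = solve-∀

  ≈-refl : ∀ {x} → x ≈ x
  ≈-refl = ≈-reflexive refl

  ≈-sym : ∀ {x y} → x ≈ y → y ≈ x
  ≈-sym {y = y} (congruent q refl) = congruent (- q) (lemma y q (+ m))
    where lemma : ∀ y q m → y ≡ y + q · m + - q · m
          lemma = solve-∀

  ≈-trans : ∀ {x y z} → x ≈ y → y ≈ z → x ≈ z
  ≈-trans {z = z} (congruent q refl) (congruent r refl) = congruent (r + q) (lemma z q r (+ m))
    where lemma : ∀ z q r m → z + r · m + q · m ≡ z + (r + q) · m
          lemma = solve-∀

  ≈-isEquivalence : IsEquivalence _≈_
  ≈-isEquivalence = record { refl = ≈-refl ; sym = ≈-sym ; trans = ≈-trans }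

  ≈-setoid : Setoid 0ℓ 0ℓ
  ≈-setoid = record { isEquivalence = ≈-isEquivalence }

  +-cong : ∀ {x x′ y y′} → x ≈ x′ → y ≈ y′ → x + y ≈ x′ + y′
  +-cong {x′ = x} {y′ = y} (congruent q refl) (congruent r refl) = congruent (q + r) (lemma x y q r (+ m))
    where lemma : ∀ x y q r m → x + q · m + (y + r · m) ≡ x + y + (q + r) · m
          lemma = solve-∀

  *-cong : ∀ {x x′ y y′} → x ≈ x′ → y ≈ y′ → x · y ≈ x′ · y′
  *-cong {x′ = x} {y′ = y} (congruent q refl) (congruent r refl) =
    congruent (q · y + r · x + q · r · + m) (lemma x y q r (+ m))
    where lemma : ∀ x y q r m → (x + q · m) · (y + r · m) ≡ x · y + (q · y + r · x + q · r · m) · m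
          lemma = solve-∀

  -‿cong : ∀ {x y} → x ≈ y → - x ≈ - y
  -‿cong {y = y} (congruent q refl) = congruent (- q) (lemma y q (+ m))
    where lemma : ∀ y q m → - (y + q · m) ≡ - y + - q · m
          lemma = solve-∀

  module ≈-Reasoning = Relation.Binary.Reasoning.Setoid ≈-setoid

  ≈0⇒≈ : ∀ {x y} → x - y ≈ 0ℤ → x ≈ y
  ≈0⇒≈ {x} {y} x-y≈0 = let open ≈-Reasoning in begin
    x            ≡⟨ split x y ⟩
    (x - y) + y  ≈⟨ +-cong x-y≈0 ≈-refl ⟩
    0ℤ + y       ≡⟨ +-identityˡ y ⟩
    y            ∎
    where split : ∀ x y → x ≡ (x - y) + y
          split = solve-∀

  ≈⇒≈0 : ∀ {x y} → x ≈ y → x - y ≈ 0ℤ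
  ≈⇒≈0 {x} {y} x≈y = let open ≈-Reasoning in begin
    x - y  ≈⟨ +-cong x≈y ≈-refl ⟩
    y - y  ≡⟨ cancel y ⟩
    0ℤ     ∎
    where cancel : ∀ y → y - y ≡ 0ℤ
          cancel = solve-∀

  +-cancelʳ-≈ : ∀ {x y} z → x + z ≈ y + z → x ≈ y
  +-cancelʳ-≈ {x} {y} z x+z≈y+z = let open ≈-Reasoning in begin
    x              ≡⟨ lemma x z ⟩
    (x + z) - z    ≈⟨ +-cong x+z≈y+z ≈-refl ⟩
    (y + z) - z    ≡⟨ lemma y z ⟨
    y              ∎
    where lemma : ∀ x z → x ≡ (x + z) - z
          lemma = solve-∀

  module _ .{{_ : NonZero m}} where

    +[a%m]≈+a : ∀ a → + (a % m) ≈ + a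
    +[a%m]≈+a a = ≈-sym (congruent (+ (a / m)) (begin
      + a                            ≡⟨ cong +_ (m≡m%n+[m/n]*n a m) ⟩
      + (a % m ℕ.+ a / m ℕ.* m)      ≡⟨ pos-+ (a % m) _ ⟩
      + (a % m) + + (a / m ℕ.* m)    ≡⟨ cong (λ t → + (a % m) + t) (pos-* (a / m) m) ⟩
      + (a % m) + + (a / m) · + m    ∎))
      where open ≡-Reasoning

    ≈⇒%≡ : ∀ {a b} → + a ≈ + b → a % m ≡ b % m
    ≈⇒%≡ {a} {b} (congruent (+ k) eq) = begin
      a % m               ≡⟨ cong (_% m) (+-injective (trans eq (sym (lift b k)))) ⟩
      (b ℕ.+ k ℕ.* m) % m  ≡⟨ [m+kn]%n≡m%n b k m ⟩
      b % m               ∎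
      where open ≡-Reasoning
            lift : ∀ b k → + (b ℕ.+ k ℕ.* m) ≡ + b + + k · + m
            lift b k = trans (pos-+ b (k ℕ.* m)) (cong (λ t → + b + t) (pos-* k m))
    ≈⇒%≡ {a} {b} (congruent -[1+ k ] eq) = sym (≈⇒%≡ (congruent (+ suc k) b≡a+km))
      where lemma : ∀ b k m → b ≡ b + (- k) · m + k · m
            lemma = solve-∀
            b≡a+km : + b ≡ + a + + suc k · + m
            b≡a+km = trans (lemma (+ b) (+ suc k) (+ m)) (cong (λ t → t + + suc k · + m) (sym eq))

    %≡⇒≈ : ∀ {a b} → a % m ≡ b % m → + a ≈ + b
    %≡⇒≈ {a} {b} eq = ≈-trans (≈-sym (+[a%m]≈+a a)) (≈-trans (≈-reflexive (cong +_ eq)) (+[a%m]≈+a b))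

    ≈⇒≡ : ∀ {a b} → a ℕ.< m → b ℕ.< m → + a ≈ + b → a ≡ b
    ≈⇒≡ {a} {b} a<m b<m a≈b = begin
      a      ≡⟨ m<n⇒m%n≡m a<m ⟨
      a % m  ≡⟨ ≈⇒%≡ a≈b ⟩
      b % m  ≡⟨ m<n⇒m%n≡m b<m ⟩
      b      ∎
      where open ≡-Reasoning

  +[m∸b]≈-b : ∀ {b} → b ℕ.≤ m → + (m ℕ.∸ b) ≈ - + b
  +[m∸b]≈-b {b} b≤m = let open ≈-Reasoning in begin
    + (m ℕ.∸ b)    ≡⟨ trans (m-n≡m⊖n m b) (⊖-≥ b≤m) ⟨
    + m - + b      ≈⟨ +-cong {+ m} {0ℤ} (congruent (+ 1) (m≡0+1m (+ m))) (≈-refl { - + b}) ⟩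
    0ℤ - + b       ≡⟨ +-identityˡ (- + b) ⟩
    - + b          ∎
    where m≡0+1m : ∀ m → m ≡ 0ℤ + + 1 · m
          m≡0+1m = solve-∀

  ∣⇒≈0 : ∀ {x} → + m ∣ x → x ≈ 0ℤ
  ∣⇒≈0 (divides q eq) = congruent q (trans eq (sym (+-identityˡ _)))

  ≈0⇒∣ : ∀ {x} → x ≈ 0ℤ → + m ∣ x
  ≈0⇒∣ (congruent q eq) = divides q (trans eq (+-identityˡ _))

  prime-≈0 : Prime m → ∀ x y → x · y ≈ 0ℤ → x ≈ 0ℤ ⊎ y ≈ 0ℤ
  prime-≈0 m-prime x y xy≈0
    with euclidsLemma ∣ x ∣ ∣ y ∣ m-prime (subst (m ℕ.∣_) (abs-* x y) (∣⇒∣ᵤ (≈0⇒∣ xy≈0)))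
  ... | inj₁ m∣x = inj₁ (∣⇒≈0 (∣ᵤ⇒∣ m∣x))
  ... | inj₂ m∣y = inj₂ (∣⇒≈0 (∣ᵤ⇒∣ m∣y))

module Counting where

  open import Level using (Level)
  open import Data.Nat using (suc; _+_; z≤n; s≤s)
  open import Data.Nat.Properties using (≤-trans; ≤-reflexive; <-irrefl; <-≤-trans; +-suc)
  open import Data.Product using (_,_)
  open import Function using (_∘_)
  open import Data.List using ([]; _∷_; map; filter; cartesianProduct; _++_)
  open import Data.List.Properties using (length-removeAt′; length-map; length-++)
  open import Data.List.Relation.Unary.All as All using ([]; _∷_)
  open import Data.List.Relation.Unary.All.Properties using (¬Any⇒All¬; map⁺)
  open import Data.List.Relation.Unary.Any using (here; there; _─_)
  open import Data.List.Relation.Unary.AllPairs using ([]; _∷_)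
  open import Data.List.Membership.Propositional using (_∈_; _∉_)
  open import Data.Empty using (⊥-elim)
  open import Relation.Nullary using (yes; no; ¬?)
  open import Relation.Unary using (Pred; Decidable)
  open import Relation.Binary.Definitions using (DecidableEquality)
  open import Relation.Binary.PropositionalEquality

  private variable
    a b ℓ : Level
    A : Set a
    B : Set b
    x y : A
    xs ys : List A

  ∈-─⁺ : (x∈ys : x ∈ ys) → y ∈ ys → y ≢ x → y ∈ (ys ─ x∈ys)
  ∈-─⁺ (here refl) (here refl) y≢x = ⊥-elim (y≢x refl)
  ∈-─⁺ (here _)    (there y∈)  _   = y∈
  ∈-─⁺ (there _)   (here refl) _   = here refl
  ∈-─⁺ (there x∈)  (there y∈)  y≢x = there (∈-─⁺ x∈ y∈ y≢x)

  ⊆-─⁺ : (x∈ys : x ∈ ys) → All (_∈ ys) xs → All (_≢ x) xs → All (_∈ (ys ─ x∈ys)) xs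
  ⊆-─⁺ x∈ys xs⊆ys xs≢x = All.zipWith (λ (y∈ , y≢x) → ∈-─⁺ x∈ys y∈ y≢x) (xs⊆ys , xs≢x)

  unique-⊆⇒length≤ : Unique xs → All (_∈ ys) xs → length xs ≤ length ys
  unique-⊆⇒length≤ [] [] = z≤n
  unique-⊆⇒length≤ {ys = ys} (x≢xs ∷ xs-unique) (x∈ys ∷ xs⊆ys) = ≤-trans
    (s≤s (unique-⊆⇒length≤ xs-unique (⊆-─⁺ x∈ys xs⊆ys (All.map (λ x≢y y≡x → x≢y (sym y≡x)) x≢xs))))
    (≤-reflexive (sym (length-removeAt′ ys _)))

  unique-⊂⇒length< : Unique xs → All (_∈ ys) xs → y ∈ ys → y ∉ xs → length xs < length ys
  unique-⊂⇒length< {xs = xs} {ys = ys} xs-unique xs⊆ys y∈ys y∉xs = ≤-trans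
    (s≤s (unique-⊆⇒length≤ xs-unique (⊆-─⁺ y∈ys xs⊆ys (All.map (λ y≢x x≡y → y≢x (sym x≡y)) (¬Any⇒All¬ xs y∉xs)))))
    (≤-reflexive (sym (length-removeAt′ ys _)))

  module _ (_≟_ : DecidableEquality A) where
    open import Data.List.Membership.DecPropositional _≟_ using (_∈?_)

    unique-⊆∧length≥⇒⊇ : ∀ {xs ys} {y : A} → Unique xs → All (_∈ ys) xs → length ys ≤ length xs → y ∈ ys → y ∈ xs
    unique-⊆∧length≥⇒⊇ {xs = xs} {y = y} xs-unique xs⊆ys ys≤xs y∈ys with y ∈? xs
    ... | yes y∈xs = y∈xs
    ... | no  y∉xs = ⊥-elim (<-irrefl refl (<-≤-trans (unique-⊂⇒length< xs-unique xs⊆ys y∈ys y∉xs) ys≤xs))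

  map-unique : {P : Pred A ℓ} (f : A → B) → (∀ {x y} → P x → P y → f x ≡ f y → x ≡ y) →
    All P xs → Unique xs → Unique (map f xs)
  map-unique f f-inj [] [] = []
  map-unique f f-inj (px ∷ pxs) (x≢xs ∷ xs-unique) =
    map⁺ (All.zipWith (λ (py , x≢y) fx≡fy → x≢y (f-inj px py fx≡fy)) (pxs , x≢xs)) ∷ map-unique f f-inj pxs xs-unique

  nonempty⇒∈ : 1 ≤ length xs → ∃[ x ] x ∈ xs
  nonempty⇒∈ {xs = x ∷ _} _ = x , here refl

  unique⇒two-distinct : Unique xs → 2 ≤ length xs → ∃[ x ] ∃[ y ] x ∈ xs × y ∈ xs × x ≢ y
  unique⇒two-distinct {xs = _ ∷ []}    _                (s≤s ())
  unique⇒two-distinct {xs = x ∷ y ∷ _} ((x≢y ∷ _) ∷ _) _ = x , y , here refl , there (here refl) , x≢y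

  length-cartesianProduct : (xs : List A) (ys : List B) → length (cartesianProduct xs ys) ≡ length xs * length ys
  length-cartesianProduct [] ys = refl
  length-cartesianProduct (x ∷ xs) ys = begin
    length (map (x ,_) ys ++ cartesianProduct xs ys)  ≡⟨ length-++ (map (x ,_) ys) ⟩
    length (map (x ,_) ys) + length (cartesianProduct xs ys)  ≡⟨ cong₂ _+_ (length-map (x ,_) ys) (length-cartesianProduct xs ys) ⟩
    length ys + length xs * length ys  ∎
    where open ≡-Reasoning

  length-filter+filter-∁ : {P : Pred A ℓ} (P? : Decidable P) (xs : List A) →
    length (filter P? xs) + length (filter (¬? ∘ P?) xs) ≡ length xs
  length-filter+filter-∁ P? [] = refl
  length-filter+filter-∁ P? (x ∷ xs) with P? x
  ... | yes _ = cong suc (length-filter+filter-∁ P? xs)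
  ... | no  _ = trans (+-suc _ _) (cong suc (length-filter+filter-∁ P? xs))

module AffineLines (p : ℕ) .{{_ : NonZero p}} (p-prime : Prime p) where

  open import Data.Nat as ℕ using (_+_)
  open import Data.Nat.Properties using (_≟_; ≤-reflexive)
  open import Data.List using (map; upTo; cartesianProduct)
  open import Data.List.Properties using (length-map; length-upTo)
  open import Data.List.Relation.Unary.All as All using ()
  open import Data.List.Relation.Unary.All.Properties using (map⁺)
  open import Data.List.Relation.Unary.Unique.Propositional.Properties using (upTo⁺; cartesianProduct⁺)
  open import Data.List.Membership.Propositional using (_∈_)
  open import Data.List.Membership.Propositional.Properties
    using (∈-map⁻; ∈-upTo⁺; ∈-upTo⁻; ∈-cartesianProduct⁺; ∈-cartesianProduct⁻)
  open import Data.Product.Properties using (≡-dec)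
  open import Data.Nat.DivMod using (_%_; m%n<n)
  open import Data.Fin using (toℕ)
  open import Data.Fin.Properties using (toℕ<n; toℕ-injective)
  open import Data.Integer using (ℤ; +_; 0ℤ; _-_) renaming (_+_ to _+ℤ_; _*_ to _·_)
  open import Data.Integer.Properties using (pos-+; pos-*)
  open import Data.Integer.Tactic.RingSolver using (solve-∀)
  open import Data.Product using (_,_; proj₁; proj₂; ∃-syntax)
  open import Data.Sum using ([_,_]′)
  open import Data.Empty using (⊥-elim)
  open import Relation.Binary.PropositionalEquality
  open Congruence p
  open Counting

  Point : Set
  Point = ℕ × ℕ

  OnGrid : Point → Set
  OnGrid (a , c) = a < p × c < p

  line : Fin p → Point → ℕ
  line k (a , c) = (c + toℕ k * a) % p

  line<p : ∀ k P → line k P < p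
  line<p k (a , c) = m%n<n _ p

  lineℤ : Fin p → Point → ℤ
  lineℤ k (a , c) = + c +ℤ + toℕ k · + a

  line≈lineℤ : ∀ k P → + line k P ≈ lineℤ k P
  line≈lineℤ k (a , c) = let open ≈-Reasoning in begin
    + line k (a , c)         ≈⟨ +[a%m]≈+a (c + toℕ k * a) ⟩
    + (c + toℕ k * a)        ≡⟨ pos-+ c (toℕ k * a) ⟩
    + c +ℤ + (toℕ k * a)     ≡⟨ cong (+ c +ℤ_) (pos-* (toℕ k) a) ⟩
    + c +ℤ + toℕ k · + a     ∎

  distinct-slopes-determine : ∀ {k k′} → k ≢ k′ → ∀ {a c a′ c′} →
    c +ℤ + toℕ k · a ≈ c′ +ℤ + toℕ k · a′ → c +ℤ + toℕ k′ · a ≈ c′ +ℤ + toℕ k′ · a′ →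
    a ≈ a′ × c ≈ c′
  distinct-slopes-determine {k} {k′} k≢k′ {a} {c} {a′} {c′} eqk eqk′ = a≈a′ , c≈c′
    where
    K K′ : ℤ
    K = + toℕ k
    K′ = + toℕ k′
    expand : ∀ K K′ a c a′ c′ → (K - K′) · (a - a′) ≡
               ((c +ℤ K · a) - (c′ +ℤ K · a′)) - ((c +ℤ K′ · a) - (c′ +ℤ K′ · a′))
    expand = solve-∀
    [K-K′][a-a′]≈0 : (K - K′) · (a - a′) ≈ 0ℤ
    [K-K′][a-a′]≈0 = let open ≈-Reasoning in begin
      (K - K′) · (a - a′)                                                 ≡⟨ expand K K′ a c a′ c′ ⟩
      ((c +ℤ K · a) - (c′ +ℤ K · a′)) - ((c +ℤ K′ · a) - (c′ +ℤ K′ · a′))  ≈⟨ +-cong (≈⇒≈0 eqk) (-‿cong (≈⇒≈0 eqk′)) ⟩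
      0ℤ                                                                  ∎
    a≈a′ : a ≈ a′
    a≈a′ = [ (λ K-K′≈0 → ⊥-elim (k≢k′ (toℕ-injective (≈⇒≡ (toℕ<n k) (toℕ<n k′) (≈0⇒≈ K-K′≈0)))))
           , ≈0⇒≈ ]′ (prime-≈0 p-prime (K - K′) (a - a′) [K-K′][a-a′]≈0)
    c≈c′ : c ≈ c′
    c≈c′ = +-cancelʳ-≈ (K · a) (≈-trans eqk (+-cong (≈-refl {c′}) (*-cong (≈-refl {K}) (≈-sym a≈a′))))

  line≡⇒lineℤ≈ : ∀ k {P Q} → line k P ≡ line k Q → lineℤ k P ≈ lineℤ k Q
  line≡⇒lineℤ≈ k {P} {Q} eq = ≈-trans (≈-sym (line≈lineℤ k P)) (≈-trans (≈-reflexive (cong +_ eq)) (line≈lineℤ k Q))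

  lines-meet-once : ∀ {k k′} → k ≢ k′ → ∀ {P Q} → OnGrid P → OnGrid Q →
    line k P ≡ line k Q → line k′ P ≡ line k′ Q → P ≡ Q
  lines-meet-once {k} {k′} k≢k′ (a<p , c<p) (a′<p , c′<p) eqk eqk′ =
    let a≈a′ , c≈c′ = distinct-slopes-determine k≢k′ (line≡⇒lineℤ≈ k eqk) (line≡⇒lineℤ≈ k′ eqk′)
    in cong₂ _,_ (≈⇒≡ a<p a′<p a≈a′) (≈⇒≡ c<p c′<p c≈c′)

  column-meets-line-once : ∀ k {a c c′} → c < p → c′ < p → line k (a , c) ≡ line k (a , c′) → c ≡ c′
  column-meets-line-once k {a} c<p c′<p eq = ≈⇒≡ c<p c′<p (+-cancelʳ-≈ (+ toℕ k · + a) (line≡⇒lineℤ≈ k eq))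

  Δa Δc : Point → Point → ℤ
  Δa P Q = + proj₁ P - + proj₁ Q
  Δc P Q = + proj₂ P - + proj₂ Q

  line-difference : ∀ k P Q → + line k P - + line k Q ≈ Δc P Q +ℤ + toℕ k · Δa P Q
  line-difference k P@(a , c) Q@(a′ , c′) = let open ≈-Reasoning in begin
    + line k P - + line k Q                  ≈⟨ +-cong (line≈lineℤ k P) (-‿cong (line≈lineℤ k Q)) ⟩
    lineℤ k P - lineℤ k Q                    ≡⟨ expand (+ c) (+ toℕ k) (+ a) (+ c′) (+ a′) ⟩
    Δc P Q +ℤ + toℕ k · Δa P Q               ∎
    where expand : ∀ c K a c′ a′ → (c +ℤ K · a) - (c′ +ℤ K · a′) ≡ (c - c′) +ℤ K · (a - a′)
          expand = solve-∀

  translation-determined : ∀ {k k′} → k ≢ k′ → ∀ {B A B₀ A₀} →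
    + line k B - + line k A ≈ + line k B₀ - + line k A₀ →
    + line k′ B - + line k′ A ≈ + line k′ B₀ - + line k′ A₀ →
    ∀ k″ → + line k″ B - + line k″ A ≈ + line k″ B₀ - + line k″ A₀
  translation-determined {k} {k′} k≢k′ {B} {A} {B₀} {A₀} eqk eqk′ k″ =
    let Δa≈ , Δc≈ = distinct-slopes-determine k≢k′ {Δa B A} {Δc B A} {Δa B₀ A₀} {Δc B₀ A₀}
                      (in-coordinates k eqk) (in-coordinates k′ eqk′)
    in let open ≈-Reasoning in begin
      + line k″ B - + line k″ A         ≈⟨ line-difference k″ B A ⟩
      Δc B A +ℤ + toℕ k″ · Δa B A       ≈⟨ +-cong Δc≈ (*-cong (≈-refl {+ toℕ k″}) Δa≈) ⟩
      Δc B₀ A₀ +ℤ + toℕ k″ · Δa B₀ A₀   ≈⟨ line-difference k″ B₀ A₀ ⟨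
      + line k″ B₀ - + line k″ A₀       ∎
    where
    in-coordinates : ∀ k → + line k B - + line k A ≈ + line k B₀ - + line k A₀ →
      Δc B A +ℤ + toℕ k · Δa B A ≈ Δc B₀ A₀ +ℤ + toℕ k · Δa B₀ A₀
    in-coordinates k eq = ≈-trans (≈-sym (line-difference k B A)) (≈-trans eq (line-difference k B₀ A₀))

  grid : List Point
  grid = cartesianProduct (upTo p) (upTo p)

  grid-unique : Unique grid
  grid-unique = cartesianProduct⁺ (upTo⁺ p) (upTo⁺ p)

  length-grid : length grid ≡ p * p
  length-grid = trans (length-cartesianProduct (upTo p) (upTo p)) (cong₂ _*_ (length-upTo p) (length-upTo p))

  ∈-grid⁺ : ∀ {P} → OnGrid P → P ∈ grid
  ∈-grid⁺ (a<p , c<p) = ∈-cartesianProduct⁺ (∈-upTo⁺ a<p) (∈-upTo⁺ c<p)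

  ∈-grid⁻ : ∀ {P} → P ∈ grid → OnGrid P
  ∈-grid⁻ P∈grid = let a∈ , c∈ = ∈-cartesianProduct⁻ (upTo p) (upTo p) P∈grid in ∈-upTo⁻ a∈ , ∈-upTo⁻ c∈

  unique-onGrid⇒length≤p*p : ∀ {Ps} → Unique Ps → All OnGrid Ps → length Ps ≤ p * p
  unique-onGrid⇒length≤p*p Ps-unique Ps-onGrid =
    subst (_ ≤_) length-grid (unique-⊆⇒length≤ Ps-unique (All.map ∈-grid⁺ Ps-onGrid))

  -- The map P ↦ (line k P , line k′ P) is injective on the grid, hence onto it by counting.
  lines-meet : ∀ {k k′} → k ≢ k′ → ∀ {y z} → y < p → z < p →
    ∃[ P ] OnGrid P × line k P ≡ y × line k′ P ≡ z
  lines-meet {k} {k′} k≢k′ {y} {z} y<p z<p =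
    let P , P∈grid , yz≡ = ∈-map⁻ lines (unique-⊆∧length≥⇒⊇ (≡-dec _≟_ _≟_) lines-unique lines⊆grid
                                           (≤-reflexive (sym (length-map lines grid))) (∈-grid⁺ (y<p , z<p)))
    in P , ∈-grid⁻ P∈grid , cong proj₁ (sym yz≡) , cong proj₂ (sym yz≡)
    where
    lines : Point → Point
    lines P = line k P , line k′ P
    lines-unique : Unique (map lines grid)
    lines-unique = map-unique lines (λ P Q eq → lines-meet-once k≢k′ P Q (cong proj₁ eq) (cong proj₂ eq))
                     (All.tabulate ∈-grid⁻) grid-unique
    lines⊆grid : All (_∈ grid) (map lines grid)
    lines⊆grid = map⁺ (All.universal (λ P → ∈-grid⁺ (line<p k P , line<p k′ P)) grid)

  module _ {k k′ : Fin p} (k≢k′ : k ≢ k′) where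

    meet : ℕ → ℕ → Point
    meet y z = proj₁ (lines-meet k≢k′ (m%n<n y p) (m%n<n z p))

    meet-onGrid : ∀ y z → OnGrid (meet y z)
    meet-onGrid y z = proj₁ (proj₂ (lines-meet k≢k′ (m%n<n y p) (m%n<n z p)))

    line-meetˡ : ∀ y z → line k (meet y z) ≡ y % p
    line-meetˡ y z = proj₁ (proj₂ (proj₂ (lines-meet k≢k′ (m%n<n y p) (m%n<n z p))))

    line-meetʳ : ∀ y z → line k′ (meet y z) ≡ z % p
    line-meetʳ y z = proj₂ (proj₂ (proj₂ (lines-meet k≢k′ (m%n<n y p) (m%n<n z p))))

module TranslationOrbit (p : ℕ) .{{_ : NonZero p}} (p-prime : Prime p) where

  open import Data.Nat using (zero; suc; _+_)
  open import Data.Nat.Properties using (+-identityʳ; +-assoc; +-comm)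
  open import Data.Nat.DivMod using (_%_; %-distribˡ-+; m%n%n≡m%n; m<n⇒m%n≡m)
  open import Data.Integer using (+_; 0ℤ; _-_) renaming (_+_ to _+ℤ_; _*_ to _·_)
  open import Data.Integer.Properties using (pos-+; pos-*)
  open import Data.Integer.Tactic.RingSolver using (solve-∀)
  open import Data.List using (map; upTo)
  open import Data.List.Properties using (length-map; length-upTo)
  open import Data.List.Relation.Unary.All as All using ()
  open import Data.List.Relation.Unary.All.Properties using (map⁺)
  open import Data.List.Relation.Unary.Unique.Propositional.Properties using (upTo⁺)
  open import Data.List.Membership.Propositional using (_∈_)
  open import Data.List.Membership.Propositional.Properties using (∈-upTo⁻)
  open import Data.Sum using ([_,_]′)
  open import Data.Empty using (⊥-elim)
  open import Relation.Nullary using (¬_)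
  open import Relation.Binary.PropositionalEquality
  open Congruence p
  open Counting

  module _ {t} (t≉0 : ¬ (+ t ≈ 0ℤ)) (x₀ : ℕ) where

    orbit : ℕ → ℕ
    orbit m = (x₀ + m * t) % p

    orbit-suc : ∀ m → orbit (suc m) ≡ (orbit m + t) % p
    orbit-suc m = begin
      (x₀ + (t + m * t)) % p          ≡⟨ cong (_% p) (shuffle x₀ t (m * t)) ⟩
      ((x₀ + m * t) + t) % p          ≡⟨ %-distribˡ-+ (x₀ + m * t) t p ⟩
      (orbit m + t % p) % p           ≡⟨ cong (λ u → (u + t % p) % p) (m%n%n≡m%n (x₀ + m * t) p) ⟨
      (orbit m % p + t % p) % p       ≡⟨ %-distribˡ-+ (orbit m) t p ⟨
      (orbit m + t) % p               ∎
      where open ≡-Reasoning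
            shuffle : ∀ a b c → a + (b + c) ≡ (a + c) + b
            shuffle a b c = trans (cong (λ u → a + u) (+-comm b c)) (sym (+-assoc a c b))

    orbit-injective : ∀ {m m′} → m < p → m′ < p → orbit m ≡ orbit m′ → m ≡ m′
    orbit-injective {m} {m′} m<p m′<p eq =
      [ (λ m-m′≈0 → ≈⇒≡ m<p m′<p (≈0⇒≈ m-m′≈0)) , (λ t≈0 → ⊥-elim (t≉0 t≈0)) ]′
        (prime-≈0 p-prime (+ m - + m′) (+ t) [m-m′]t≈0)
      where
      [m-m′]t≈0 : (+ m - + m′) · + t ≈ 0ℤ
      [m-m′]t≈0 = let open ≈-Reasoning in begin
        (+ m - + m′) · + t                                ≡⟨ expand (+ x₀) (+ m) (+ m′) (+ t) ⟩
        (+ x₀ +ℤ + m · + t) - (+ x₀ +ℤ + m′ · + t)         ≡⟨ cong₂ _-_ (lift m) (lift m′) ⟩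
        + (x₀ + m * t) - + (x₀ + m′ * t)                   ≈⟨ ≈⇒≈0 (%≡⇒≈ eq) ⟩
        0ℤ                                                 ∎
        where expand : ∀ x m m′ t → (m - m′) · t ≡ (x +ℤ m · t) - (x +ℤ m′ · t)
              expand = solve-∀
              lift : ∀ m → + x₀ +ℤ + m · + t ≡ + (x₀ + m * t)
              lift m = sym (trans (pos-+ x₀ (m * t)) (cong (+ x₀ +ℤ_) (pos-* m t)))

    translation-closed⇒length≥p : ∀ {S} → Unique S → x₀ < p → x₀ ∈ S →
      (∀ {x} → x ∈ S → (x + t) % p ∈ S) → p ≤ length S
    translation-closed⇒length≥p {S} S-unique x₀<p x₀∈S closed = begin
      p                            ≡⟨ length-upTo p ⟨
      length (upTo p)              ≡⟨ length-map orbit (upTo p) ⟨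
      length (map orbit (upTo p))  ≤⟨ unique-⊆⇒length≤ orbit-unique (map⁺ (All.universal orbit∈S (upTo p))) ⟩
      length S                     ∎
      where
      open Data.Nat.Properties.≤-Reasoning
      orbit∈S : ∀ m → orbit m ∈ S
      orbit∈S zero    = subst (_∈ S) (sym (trans (cong (_% p) (+-identityʳ x₀)) (m<n⇒m%n≡m x₀<p))) x₀∈S
      orbit∈S (suc m) = subst (_∈ S) (sym (orbit-suc m)) (closed (orbit∈S m))
      orbit-unique : Unique (map orbit (upTo p))
      orbit-unique = map-unique orbit orbit-injective (All.tabulate ∈-upTo⁻) (upTo⁺ p)

module Arithmetic where

  open import Data.Nat using (suc; _+_; z≤n; s≤s)
  open import Data.Nat.Properties
  open import Data.Nat.Tactic.RingSolver using (solve-∀)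
  open import Data.Nat.Primality using (composite)
  open import Data.Nat.Divisibility using (divides)
  open import Data.Product using (_,_)
  open import Relation.Binary.PropositionalEquality

  m≤n∸1⇒m<n : ∀ {m n} .{{_ : NonZero n}} → m ≤ n ∸ 1 → m < n
  m≤n∸1⇒m<n {n = suc _} m≤n-1 = s≤s m≤n-1

  m+k*n<k*o⇒m<k*[o∸n] : ∀ m k n o → m + k * n < k * o → m < k * (o ∸ n)
  m+k*n<k*o⇒m<k*[o∸n] m k n o lt = subst (m <_) (sym (*-distribˡ-∸ k o n)) (m+n≤o⇒m≤o∸n (suc m) lt)

  2*l≡l+l : ∀ l → 2 * l ≡ l + l
  2*l≡l+l l = cong (l +_) (+-identityʳ l)

  private
    half-difference : ∀ l a b → suc (suc l + a) + b ≡ 2 * l → l ≡ suc a + suc b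
    half-difference l a b eq = +-cancelˡ-≡ l _ _ (trans (sym (2*l≡l+l l)) (trans (sym eq) (shuffle l a b)))
      where shuffle : ∀ l a b → suc (suc l + a) + b ≡ l + (suc a + suc b)
            shuffle = solve-∀

    complement : ∀ s₁ e w → suc (2 * (s₁ + e)) + w ≡ s₁ + suc (s₁ + 2 * e + w)
    complement = solve-∀

  -- With p = l + A and 2l = p + B the slack l (3p) - l (2l) - p p equals A B.
  grid-count : ∀ {l p} → l < p → p < 2 * l → p * p + l * (2 * l) < l * (3 * p)
  grid-count {l} l<p p<2l
    with a , refl ← m≤n⇒∃[o]m+o≡n l<p
    with b , eq   ← m≤n⇒∃[o]m+o≡n p<2l
    with refl     ← half-difference l a b eq =
    subst (P * P + L * (2 * L) <_) (identity a b) (m<m+n _ (s≤s z≤n))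
    where
    L P : ℕ
    L = suc a + suc b
    P = suc L + a
    identity : ∀ a b → let l = suc a + suc b ; p = suc l + a in
      p * p + l * (2 * l) + suc a * suc b ≡ l * (3 * p)
    identity = solve-∀

  -- The slack l (3p) - l (2l) - s₁ p - c s equals c (2l - s) + (l - s₁) (p - 2l),
  -- which dominates (l - s₁) + (2l - s) because c ≥ 1 and p - 2l ≥ 1.
  slot-count : ∀ {l p s₁ c s} → 2 * l < p → s₁ + c ≡ p → s₁ ≤ l → s ≤ 2 * l →
    s₁ * p + c * s + ((l ∸ s₁) + (2 * l ∸ s)) + l * (2 * l) ≤ l * (3 * p)
  slot-count {s₁ = s₁} {c} {s} 2l<p s₁+c≡p s₁≤l s≤2l
    with e , refl ← m≤n⇒∃[o]m+o≡n s₁≤l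
    with w , refl ← m≤n⇒∃[o]m+o≡n 2l<p
    with refl     ← +-cancelˡ-≡ s₁ c _ (trans s₁+c≡p (complement s₁ e w))
    with d , s+d≡2l ← m≤n⇒∃[o]m+o≡n s≤2l = begin
    s₁ * p + c * s + ((l ∸ s₁) + (2 * l ∸ s)) + l * (2 * l)  ≡⟨ cong (λ slack → s₁ * p + c * s + slack + l * (2 * l)) slack≡ ⟩
    s₁ * p + c * s + (e + d) + l * (2 * l)                    ≤⟨ +-monoˡ-≤ (l * (2 * l)) (+-monoʳ-≤ (s₁ * p + c * s) (+-mono-≤ (m≤m*n e (suc w)) (m≤n*m d c))) ⟩
    s₁ * p + c * s + (e * suc w + c * d) + l * (2 * l)        ≡⟨ regroup (s₁ * p) c s d (e * suc w) (l * (2 * l)) ⟩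
    s₁ * p + c * (s + d) + e * suc w + l * (2 * l)            ≡⟨ cong (λ t → s₁ * p + c * t + e * suc w + l * (2 * l)) s+d≡2l ⟩
    s₁ * p + c * (2 * l) + e * suc w + l * (2 * l)            ≡⟨ identity s₁ e w ⟩
    l * (3 * p)                                               ∎
    where
    open ≤-Reasoning
    l p : ℕ
    l = s₁ + e
    p = suc (2 * l) + w
    slack≡ : (l ∸ s₁) + (2 * l ∸ s) ≡ e + d
    slack≡ = cong₂ _+_ (m+n∸m≡n s₁ e) (trans (cong (_∸ s) (sym s+d≡2l)) (m+n∸m≡n s d))
    regroup : ∀ x c s d y z → x + c * s + (y + c * d) + z ≡ x + c * (s + d) + y + z
    regroup = solve-∀
    identity : ∀ s₁ e w → let l = s₁ + e ; p = suc (2 * l) + w ; c = suc (s₁ + 2 * e + w) in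
      s₁ * p + c * (2 * l) + e * suc w + l * (2 * l) ≡ l * (3 * p)
    identity = solve-∀

  both-tight : ∀ {l s₁ s₂} → s₁ ≤ l → s₂ ≤ l → 2 * l ≤ s₁ + s₂ → l ≤ s₁ × l ≤ s₂
  both-tight {l} {s₁} {s₂} s₁≤l s₂≤l 2l≤s =
      +-cancelʳ-≤ s₂ l s₁ (≤-trans (+-monoʳ-≤ l s₂≤l) (subst (_≤ s₁ + s₂) (2*l≡l+l l) 2l≤s))
    , +-cancelˡ-≤ s₁ l s₂ (≤-trans (+-monoˡ-≤ l s₁≤l) (subst (_≤ s₁ + s₂) (2*l≡l+l l) 2l≤s))

  prime≢2*l : ∀ {p l} → Prime p → 2 ≤ l → 2 * l ≢ p
  prime≢2*l {l = l} p-prime 2≤l refl = Prime.notComposite p-prime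
    (composite {d = 2} (<-≤-trans (s≤s (s≤s (s≤s z≤n))) (*-monoʳ-≤ 2 2≤l)) (divides l (*-comm 2 l)))

module ThreeParallelClasses (p : ℕ) .{{_ : NonZero p}} (p-prime : Prime p)
  (k : Fin 3 → Fin p) (k-injective : Injective _≡_ _≡_ k) (V : Fin 3 → List ℕ) where

  open import Data.Nat as ℕ using (_+_; _≟_)
  open import Data.Nat.Properties
    using (≤-trans; ≤-<-trans; ≤-reflexive; +-comm; *-distribˡ-+; <⇒≤; <⇒≱; +-mono-≤; +-monoˡ-≤; +-monoˡ-<;
           m<m+n; m≤m+n; n≢0⇒n>0; m∸n≡0⇒m≤n; m+n≡0⇒m≡0; m+n≡0⇒n≡0; <-cmp)
  open import Relation.Binary.Definitions using (tri<; tri≈; tri>)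
  open import Data.Nat.DivMod using (_%_; m%n<n; m<n⇒m%n≡m)
  open import Data.Fin.Patterns using (0F; 1F; 2F)
  open import Data.Integer using (+_; 0ℤ; _-_) renaming (_+_ to _+ℤ_)
  open import Data.Integer.Properties using (pos-+)
  open import Data.Integer.Tactic.RingSolver using (solve-∀)
  open import Data.List using (map; filter; upTo; cartesianProduct; _++_)
  open import Data.List.Properties using (length-map; length-++; length-upTo)
  open import Data.List.Relation.Unary.All as All using ()
  open import Data.List.Relation.Unary.All.Properties using (map⁺; All¬⇒¬Any)
  open import Data.List.Relation.Unary.Unique.Propositional.Properties as Unique using (upTo⁺)
  open import Data.List.Membership.Propositional using (_∈_; _∉_; find; lose)
  open import Data.List.Relation.Unary.Any using (any?)
  open import Data.List.Membership.Propositional.Properties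
    using (∈-map⁺; ∈-map⁻; ∈-++⁺ˡ; ∈-++⁺ʳ; ∈-upTo⁺; ∈-upTo⁻; ∈-filter⁺; ∈-filter⁻; ∈-cartesianProduct⁺)
  open import Data.List.Membership.DecPropositional _≟_ using (_∈?_)
  open import Data.Product using (_,_; proj₁; proj₂)
  open import Data.Product.Properties using (,-injective)
  open import Data.Sum using (_⊎_; inj₁; inj₂)
  open import Data.Sum.Properties using (inj₁-injective; inj₂-injective)
  open import Data.Empty using (⊥-elim)
  open import Relation.Nullary using (¬_; Dec; yes; no; ¬?; _×-dec_)
  open import Relation.Unary using (Decidable)
  open import Relation.Binary.PropositionalEquality
  open AffineLines p p-prime
  open Congruence p
  open Counting
  open TranslationOrbit p p-prime
  open Arithmetic

  Covered : Point → Set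
  Covered P = ∃[ i ] line (k i) P ∈ V i

  chosen : Fin 3 → List ℕ
  chosen i = filter (_∈? V i) (upTo p)

  chosen-unique : ∀ i → Unique (chosen i)
  chosen-unique i = Unique.filter⁺ (_∈? V i) (upTo⁺ p)

  ∈-chosen⁺ : ∀ i P → line (k i) P ∈ V i → line (k i) P ∈ chosen i
  ∈-chosen⁺ i P = ∈-filter⁺ (_∈? V i) (∈-upTo⁺ (line<p (k i) P))

  ∈-chosen⁻ : ∀ i {u} → u ∈ chosen i → u < p × u ∈ V i
  ∈-chosen⁻ i u∈ = let u∈upTo , u∈V = ∈-filter⁻ (_∈? V i) u∈ in ∈-upTo⁻ u∈upTo , u∈V

  length-chosen≤ : ∀ i → length (chosen i) ≤ length (V i)
  length-chosen≤ i = unique-⊆⇒length≤ (chosen-unique i) (All.tabulate (λ u∈ → proj₂ (∈-chosen⁻ i u∈)))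

  unchosen₀ : List ℕ
  unchosen₀ = filter (λ u → ¬? (u ∈? V 0F)) (upTo p)

  length-chosen₀+unchosen₀ : length (chosen 0F) + length unchosen₀ ≡ p
  length-chosen₀+unchosen₀ = trans (length-filter+filter-∁ (_∈? V 0F) (upTo p)) (length-upTo p)

  k₀≢k₁ : k 0F ≢ k 1F
  k₀≢k₁ eq with () ← k-injective eq
  k₀≢k₂ : k 0F ≢ k 2F
  k₀≢k₂ eq with () ← k-injective eq
  k₁≢k₂ : k 1F ≢ k 2F
  k₁≢k₂ eq with () ← k-injective eq

  ∈-unchosen₀⁺ : ∀ P → line (k 0F) P ∉ V 0F → line (k 0F) P ∈ unchosen₀
  ∈-unchosen₀⁺ P = ∈-filter⁺ (λ u → ¬? (u ∈? V 0F)) (∈-upTo⁺ (line<p (k 0F) P))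

  Slot : Set
  Slot = ℕ × (ℕ ⊎ ℕ ⊎ ℕ)

  tag₀ tag₁ tag₂ : ℕ × ℕ → Slot
  tag₀ (x , a) = x , inj₁ a
  tag₁ (x , y) = x , inj₂ (inj₁ y)
  tag₂ (x , z) = x , inj₂ (inj₂ z)

  slots₀ slots₁ slots₂ slots : List Slot
  slots₀ = map tag₀ (cartesianProduct (chosen 0F) (upTo p))
  slots₁ = map tag₁ (cartesianProduct unchosen₀ (chosen 1F))
  slots₂ = map tag₂ (cartesianProduct unchosen₀ (chosen 2F))
  slots = slots₀ ++ slots₁ ++ slots₂

  length-slots : length slots ≡
    length (chosen 0F) * p + length unchosen₀ * (length (chosen 1F) + length (chosen 2F))
  length-slots = begin
    length (slots₀ ++ slots₁ ++ slots₂)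
      ≡⟨ length-++ slots₀ ⟩
    length slots₀ + length (slots₁ ++ slots₂)
      ≡⟨ cong (λ n → length slots₀ + n) (length-++ slots₁) ⟩
    length slots₀ + (length slots₁ + length slots₂)
      ≡⟨ cong₂ _+_ (length-tagged tag₀ (chosen 0F) (upTo p))
                   (cong₂ _+_ (length-tagged tag₁ unchosen₀ (chosen 1F)) (length-tagged tag₂ unchosen₀ (chosen 2F))) ⟩
    length (chosen 0F) * length (upTo p) + (length unchosen₀ * length (chosen 1F) + length unchosen₀ * length (chosen 2F))
      ≡⟨ cong₂ _+_ (cong (length (chosen 0F) *_) (length-upTo p)) (sym (*-distribˡ-+ (length unchosen₀) _ _)) ⟩
    length (chosen 0F) * p + length unchosen₀ * (length (chosen 1F) + length (chosen 2F))
      ∎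
    where
    open ≡-Reasoning
    length-tagged : (tag : ℕ × ℕ → Slot) (xs ys : List ℕ) →
      length (map tag (cartesianProduct xs ys)) ≡ length xs * length ys
    length-tagged tag xs ys = trans (length-map tag (cartesianProduct xs ys)) (length-cartesianProduct xs ys)

  slotBy : (P : Point) → Dec (line (k 0F) P ∈ V 0F) → Dec (line (k 1F) P ∈ V 1F) → Slot
  slotBy P (yes _) _       = tag₀ (line (k 0F) P , proj₁ P)
  slotBy P (no _)  (yes _) = tag₁ (line (k 0F) P , line (k 1F) P)
  slotBy P (no _)  (no _)  = tag₂ (line (k 0F) P , line (k 2F) P)

  slot : Point → Slot
  slot P = slotBy P (line (k 0F) P ∈? V 0F) (line (k 1F) P ∈? V 1F)

  slotBy∈slots : ∀ {P} → OnGrid P → Covered P → ∀ d₀ d₁ → slotBy P d₀ d₁ ∈ slots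
  slotBy∈slots {P} (a<p , _) _ (yes on₀) _ =
    ∈-++⁺ˡ (∈-map⁺ tag₀ (∈-cartesianProduct⁺ (∈-chosen⁺ 0F P on₀) (∈-upTo⁺ a<p)))
  slotBy∈slots {P} _ _ (no off₀) (yes on₁) =
    ∈-++⁺ʳ slots₀ (∈-++⁺ˡ (∈-map⁺ tag₁ (∈-cartesianProduct⁺ (∈-unchosen₀⁺ P off₀) (∈-chosen⁺ 1F P on₁))))
  slotBy∈slots {P} _ (2F , on₂) (no off₀) (no _) =
    ∈-++⁺ʳ slots₀ (∈-++⁺ʳ slots₁ (∈-map⁺ tag₂ (∈-cartesianProduct⁺ (∈-unchosen₀⁺ P off₀) (∈-chosen⁺ 2F P on₂))))
  slotBy∈slots _ (0F , on₀) (no off₀) (no _)    = ⊥-elim (off₀ on₀)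
  slotBy∈slots _ (1F , on₁) (no _)    (no off₁) = ⊥-elim (off₁ on₁)

  slotBy-injective : ∀ {P Q} → OnGrid P → OnGrid Q → ∀ d₀ d₁ e₀ e₁ → slotBy P d₀ d₁ ≡ slotBy Q e₀ e₁ → P ≡ Q
  slotBy-injective {a , c} {a′ , c′} (_ , c<p) (_ , c′<p) (yes _) _ (yes _) _ eq
    with x≡ , a-tag≡ ← ,-injective eq
    with refl ← inj₁-injective a-tag≡ = cong (a ,_) (column-meets-line-once (k 0F) c<p c′<p x≡)
  slotBy-injective P-grid Q-grid (no _) (yes _) (no _) (yes _) eq =
    let x≡ , y-tag≡ = ,-injective eq
    in lines-meet-once k₀≢k₁ P-grid Q-grid x≡ (inj₁-injective (inj₂-injective y-tag≡))
  slotBy-injective P-grid Q-grid (no _) (no _) (no _) (no _) eq =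
    let x≡ , z-tag≡ = ,-injective eq
    in lines-meet-once k₀≢k₂ P-grid Q-grid x≡ (inj₂-injective (inj₂-injective z-tag≡))
  slotBy-injective _ _ (yes _) _       (no _) (yes _) ()
  slotBy-injective _ _ (yes _) _       (no _) (no _)  ()
  slotBy-injective _ _ (no _)  (yes _) (yes _) _      ()
  slotBy-injective _ _ (no _)  (no _)  (yes _) _      ()
  slotBy-injective _ _ (no _)  (yes _) (no _) (no _)  ()
  slotBy-injective _ _ (no _)  (no _)  (no _) (yes _) ()

  Marked : Point → Set
  Marked P = OnGrid P × Covered P

  Exceptional : Point → Set
  Exceptional Q = line (k 0F) Q ∉ V 0F × line (k 1F) Q ∈ V 1F × line (k 2F) Q ∈ V 2F

  missed-by-slotBy : ∀ {P Q} → OnGrid P → OnGrid Q → Exceptional Q → ∀ d₀ d₁ →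
    tag₂ (line (k 0F) Q , line (k 2F) Q) ≢ slotBy P d₀ d₁
  missed-by-slotBy {P} {Q} P-grid Q-grid (_ , on₁ , _) (no _) (no off₁) eq =
    off₁ (subst (λ R → line (k 1F) R ∈ V 1F) (sym P≡Q) on₁)
    where P≡Q : P ≡ Q
          P≡Q = lines-meet-once k₀≢k₂ P-grid Q-grid (sym (proj₁ (,-injective eq)))
                  (sym (inj₂-injective (inj₂-injective (proj₂ (,-injective eq)))))
  missed-by-slotBy _ _ _ (yes _) _      ()
  missed-by-slotBy _ _ _ (no _) (yes _) ()

  slot-injective : ∀ {P Q} → OnGrid P → OnGrid Q → slot P ≡ slot Q → P ≡ Q
  slot-injective {P} {Q} P-grid Q-grid = slotBy-injective P-grid Q-grid
    (line (k 0F) P ∈? V 0F) (line (k 1F) P ∈? V 1F) (line (k 0F) Q ∈? V 0F) (line (k 1F) Q ∈? V 1F)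

  slot∈slots : ∀ {P} → Marked P → slot P ∈ slots
  slot∈slots {P} (P-grid , P-covered) = slotBy∈slots P-grid P-covered (line (k 0F) P ∈? V 0F) (line (k 1F) P ∈? V 1F)

  missed-by-slot : ∀ {P Q} → OnGrid P → OnGrid Q → Exceptional Q → tag₂ (line (k 0F) Q , line (k 2F) Q) ≢ slot P
  missed-by-slot {P} P-grid Q-grid Q-exceptional =
    missed-by-slotBy P-grid Q-grid Q-exceptional (line (k 0F) P ∈? V 0F) (line (k 1F) P ∈? V 1F)

  module _ {xs : List Point} (xs-unique : Unique xs) (xs-marked : All Marked xs) where

    slots-of-marked-unique : Unique (map slot xs)
    slots-of-marked-unique = map-unique slot slot-injective
                               (All.map proj₁ xs-marked) xs-unique

    slots-of-marked⊆slots : All (_∈ slots) (map slot xs)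
    slots-of-marked⊆slots = map⁺ (All.map slot∈slots xs-marked)

    marked≤slots : length xs ≤ length slots
    marked≤slots = subst (_≤ length slots) (length-map slot xs)
      (unique-⊆⇒length≤ slots-of-marked-unique slots-of-marked⊆slots)

    marked<slots : ∀ {Q} → OnGrid Q → Exceptional Q → length xs < length slots
    marked<slots {Q} Q-grid Q-exceptional = subst (_< length slots) (length-map slot xs)
      (unique-⊂⇒length< slots-of-marked-unique slots-of-marked⊆slots missed∈slots
        (All¬⇒¬Any (map⁺ (All.map (λ (P-grid , _) → missed-by-slot P-grid Q-grid Q-exceptional) xs-marked))))
      where
      missed∈slots : tag₂ (line (k 0F) Q , line (k 2F) Q) ∈ slots
      missed∈slots = let off₀ , _ , on₂ = Q-exceptional in
        ∈-++⁺ʳ slots₀ (∈-++⁺ʳ slots₁ (∈-map⁺ tag₂ (∈-cartesianProduct⁺ (∈-unchosen₀⁺ Q off₀) (∈-chosen⁺ 2F Q on₂))))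


  through : ℕ → ℕ → ℕ
  through z y = line (k 0F) (meet k₁≢k₂ y z)

  through-injective : ∀ z {y y′} → y < p → y′ < p → through z y ≡ through z y′ → y ≡ y′
  through-injective z {y} {y′} y<p y′<p eq = begin
    y                          ≡⟨ m<n⇒m%n≡m y<p ⟨
    y % p                      ≡⟨ line-meetˡ k₁≢k₂ y z ⟨
    line (k 1F) (meet k₁≢k₂ y z)   ≡⟨ cong (line (k 1F)) meets≡ ⟩
    line (k 1F) (meet k₁≢k₂ y′ z)  ≡⟨ line-meetˡ k₁≢k₂ y′ z ⟩
    y′ % p                     ≡⟨ m<n⇒m%n≡m y′<p ⟩
    y′                         ∎
    where
    open ≡-Reasoning
    meets≡ : meet k₁≢k₂ y z ≡ meet k₁≢k₂ y′ z
    meets≡ = lines-meet-once k₀≢k₂ (meet-onGrid k₁≢k₂ y z) (meet-onGrid k₁≢k₂ y′ z) eq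
               (trans (line-meetʳ k₁≢k₂ y z) (sym (line-meetʳ k₁≢k₂ y′ z)))

  through-translation : ∀ z₁ z₂ y y₀ → + through z₂ y - + through z₁ y ≈ + through z₂ y₀ - + through z₁ y₀
  through-translation z₁ z₂ y y₀ = translation-determined k₁≢k₂ along₁ along₂ (k 0F)
    where
    along₁ : + line (k 1F) (meet k₁≢k₂ y z₂) - + line (k 1F) (meet k₁≢k₂ y z₁) ≈
             + line (k 1F) (meet k₁≢k₂ y₀ z₂) - + line (k 1F) (meet k₁≢k₂ y₀ z₁)
    along₁ = let open ≈-Reasoning in begin
      + line (k 1F) (meet k₁≢k₂ y z₂) - + line (k 1F) (meet k₁≢k₂ y z₁)     ≡⟨ cong₂ (λ u v → + u - + v) (line-meetˡ k₁≢k₂ y z₂) (line-meetˡ k₁≢k₂ y z₁) ⟩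
      + (y % p) - + (y % p)                                                ≈⟨ ≈⇒≈0 (≈-refl {+ (y % p)}) ⟩
      0ℤ                                                                   ≈⟨ ≈⇒≈0 (≈-refl {+ (y₀ % p)}) ⟨
      + (y₀ % p) - + (y₀ % p)                                              ≡⟨ cong₂ (λ u v → + u - + v) (line-meetˡ k₁≢k₂ y₀ z₂) (line-meetˡ k₁≢k₂ y₀ z₁) ⟨
      + line (k 1F) (meet k₁≢k₂ y₀ z₂) - + line (k 1F) (meet k₁≢k₂ y₀ z₁)   ∎
    along₂ : + line (k 2F) (meet k₁≢k₂ y z₂) - + line (k 2F) (meet k₁≢k₂ y z₁) ≈
             + line (k 2F) (meet k₁≢k₂ y₀ z₂) - + line (k 2F) (meet k₁≢k₂ y₀ z₁)
    along₂ = ≈-reflexive (trans (cong₂ (λ u v → + u - + v) (line-meetʳ k₁≢k₂ y z₂) (line-meetʳ k₁≢k₂ y z₁))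
                                (sym (cong₂ (λ u v → + u - + v) (line-meetʳ k₁≢k₂ y₀ z₂) (line-meetʳ k₁≢k₂ y₀ z₁))))

  shift : ℕ → ℕ → ℕ
  shift z₁ z₂ = (through z₂ 0 + (p ∸ through z₁ 0)) % p

  +shift≈ : ∀ z₁ z₂ → + shift z₁ z₂ ≈ + through z₂ 0 - + through z₁ 0
  +shift≈ z₁ z₂ = let open ≈-Reasoning in begin
    + shift z₁ z₂                                ≈⟨ +[a%m]≈+a (through z₂ 0 + (p ∸ through z₁ 0)) ⟩
    + (through z₂ 0 + (p ∸ through z₁ 0))        ≡⟨ pos-+ (through z₂ 0) (p ∸ through z₁ 0) ⟩
    + through z₂ 0 +ℤ + (p ∸ through z₁ 0)       ≈⟨ +-cong (≈-refl {+ through z₂ 0}) (+[m∸b]≈-b (<⇒≤ (line<p (k 0F) _))) ⟩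
    + through z₂ 0 - + through z₁ 0              ∎

  shift≉0 : ∀ {z₁ z₂} → z₁ < p → z₂ < p → z₁ ≢ z₂ → ¬ (+ shift z₁ z₂ ≈ 0ℤ)
  shift≉0 {z₁} {z₂} z₁<p z₂<p z₁≢z₂ shift≈0 = z₁≢z₂ (begin
    z₁                             ≡⟨ m<n⇒m%n≡m z₁<p ⟨
    z₁ % p                         ≡⟨ line-meetʳ k₁≢k₂ 0 z₁ ⟨
    line (k 2F) (meet k₁≢k₂ 0 z₁)   ≡⟨ cong (line (k 2F)) meets≡ ⟩
    line (k 2F) (meet k₁≢k₂ 0 z₂)   ≡⟨ line-meetʳ k₁≢k₂ 0 z₂ ⟩
    z₂ % p                         ≡⟨ m<n⇒m%n≡m z₂<p ⟩
    z₂                             ∎)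
    where
    open ≡-Reasoning
    through≡ : through z₁ 0 ≡ through z₂ 0
    through≡ = sym (≈⇒≡ (line<p (k 0F) _) (line<p (k 0F) _) (≈0⇒≈ (≈-trans (≈-sym (+shift≈ z₁ z₂)) shift≈0)))
    meets≡ : meet k₁≢k₂ 0 z₁ ≡ meet k₁≢k₂ 0 z₂
    meets≡ = lines-meet-once k₀≢k₁ (meet-onGrid k₁≢k₂ 0 z₁) (meet-onGrid k₁≢k₂ 0 z₂) through≡
               (trans (line-meetˡ k₁≢k₂ 0 z₁) (sym (line-meetˡ k₁≢k₂ 0 z₂)))

  through-shift : ∀ z₁ z₂ y → (through z₁ y + shift z₁ z₂) % p ≡ through z₂ y
  through-shift z₁ z₂ y = ≈⇒≡ (m%n<n _ p) (line<p (k 0F) _) (let open ≈-Reasoning in begin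
    + ((T₁ + shift z₁ z₂) % p)              ≈⟨ +[a%m]≈+a (T₁ + shift z₁ z₂) ⟩
    + (T₁ + shift z₁ z₂)                    ≡⟨ pos-+ T₁ (shift z₁ z₂) ⟩
    + T₁ +ℤ + shift z₁ z₂                   ≈⟨ +-cong (≈-refl {+ T₁}) (+shift≈ z₁ z₂) ⟩
    + T₁ +ℤ (+ through z₂ 0 - + through z₁ 0) ≈⟨ +-cong (≈-refl {+ T₁}) (through-translation z₁ z₂ y 0) ⟨
    + T₁ +ℤ (+ T₂ - + T₁)                   ≡⟨ cancel (+ T₁) (+ T₂) ⟩
    + T₂                                    ∎)
    where
    T₁ T₂ : ℕ
    T₁ = through z₁ y
    T₂ = through z₂ y
    cancel : ∀ a b → a +ℤ (b - a) ≡ b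
    cancel = solve-∀

  module _ (closed : ∀ {P} → OnGrid P → line (k 1F) P ∈ V 1F → line (k 2F) P ∈ V 2F → line (k 0F) P ∈ V 0F) where

    through∈chosen₀ : ∀ {y z} → y ∈ chosen 1F → z ∈ chosen 2F → through z y ∈ chosen 0F
    through∈chosen₀ {y} {z} y∈ z∈ =
      let y<p , y∈V = ∈-chosen⁻ 1F y∈
          z<p , z∈V = ∈-chosen⁻ 2F z∈
      in ∈-chosen⁺ 0F (meet k₁≢k₂ y z) (closed (meet-onGrid k₁≢k₂ y z)
           (subst (_∈ V 1F) (sym (trans (line-meetˡ k₁≢k₂ y z) (m<n⇒m%n≡m y<p))) y∈V)
           (subst (_∈ V 2F) (sym (trans (line-meetʳ k₁≢k₂ y z) (m<n⇒m%n≡m z<p))) z∈V))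

    -- y ↦ through z y maps chosen 1F injectively into the no larger chosen 0F, hence onto it.
    chosen₀⊆through : ∀ {z} → z ∈ chosen 2F → length (chosen 0F) ≤ length (chosen 1F) →
      ∀ {x} → x ∈ chosen 0F → ∃[ y ] y ∈ chosen 1F × x ≡ through z y
    chosen₀⊆through {z} z∈ S₀≤S₁ x∈ =
      ∈-map⁻ (through z) (unique-⊆∧length≥⇒⊇ _≟_ image-unique image⊆chosen₀ S₀≤image x∈)
      where
      image-unique : Unique (map (through z) (chosen 1F))
      image-unique = map-unique (through z) (through-injective z)
                       (All.tabulate (λ y∈ → proj₁ (∈-chosen⁻ 1F y∈))) (chosen-unique 1F)
      image⊆chosen₀ : All (_∈ chosen 0F) (map (through z) (chosen 1F))
      image⊆chosen₀ = map⁺ (All.tabulate (λ y∈ → through∈chosen₀ y∈ z∈))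
      S₀≤image : length (chosen 0F) ≤ length (map (through z) (chosen 1F))
      S₀≤image = subst (length (chosen 0F) ≤_) (sym (length-map (through z) (chosen 1F))) S₀≤S₁

    closed⇒length≥p : ∀ {z₁ z₂ x₀} → length (chosen 0F) ≤ length (chosen 1F) →
      z₁ ∈ chosen 2F → z₂ ∈ chosen 2F → z₁ ≢ z₂ → x₀ ∈ chosen 0F → p ≤ length (chosen 0F)
    closed⇒length≥p {z₁} {z₂} {x₀} S₀≤S₁ z₁∈ z₂∈ z₁≢z₂ x₀∈ =
      translation-closed⇒length≥p (shift≉0 (proj₁ (∈-chosen⁻ 2F z₁∈)) (proj₁ (∈-chosen⁻ 2F z₂∈)) z₁≢z₂)
        x₀ (chosen-unique 0F) (proj₁ (∈-chosen⁻ 0F x₀∈)) x₀∈ closure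
      where
      closure : ∀ {x} → x ∈ chosen 0F → (x + shift z₁ z₂) % p ∈ chosen 0F
      closure x∈ = let y , y∈ , x≡ = chosen₀⊆through z₁∈ S₀≤S₁ x∈ in
        subst (_∈ chosen 0F) (sym (trans (cong (λ u → (u + shift z₁ z₂) % p) x≡) (through-shift z₁ z₂ y)))
          (through∈chosen₀ y∈ z₂∈)

  exceptional? : Decidable Exceptional
  exceptional? Q = ¬? (line (k 0F) Q ∈? V 0F) ×-dec line (k 1F) Q ∈? V 1F ×-dec line (k 2F) Q ∈? V 2F

  exceptional-point : length (chosen 0F) ≤ length (chosen 1F) → 1 ≤ length (chosen 0F) →
    2 ≤ length (chosen 2F) → length (chosen 0F) < p → ∃[ Q ] OnGrid Q × Exceptional Q
  exceptional-point S₀≤S₁ 1≤S₀ 2≤S₂ S₀<p with any? exceptional? grid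
  ... | yes some = let Q , Q∈grid , Q-exceptional = find some in Q , ∈-grid⁻ Q∈grid , Q-exceptional
  ... | no none =
    let z₁ , z₂ , z₁∈ , z₂∈ , z₁≢z₂ = unique⇒two-distinct (chosen-unique 2F) 2≤S₂
        x₀ , x₀∈ = nonempty⇒∈ 1≤S₀
    in ⊥-elim (<⇒≱ S₀<p (closed⇒length≥p closed S₀≤S₁ z₁∈ z₂∈ z₁≢z₂ x₀∈))
    where
    closed : ∀ {P} → OnGrid P → line (k 1F) P ∈ V 1F → line (k 2F) P ∈ V 2F → line (k 0F) P ∈ V 0F
    closed {P} P-grid on₁ on₂ with line (k 0F) P ∈? V 0F
    ... | yes on₀  = on₀
    ... | no  off₀ = ⊥-elim (none (lose (∈-grid⁺ P-grid) (off₀ , on₁ , on₂)))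

  module _ {l} (2≤l : 2 ≤ l) (V≤l : ∀ i → length (V i) ≤ l) {xs : List Point}
           (xs-unique : Unique xs) (xs-marked : All Marked xs) where

    private
      S≤l : ∀ i → length (chosen i) ≤ l
      S≤l i = ≤-trans (length-chosen≤ i) (V≤l i)

      slack : ℕ
      slack = (l ∸ length (chosen 0F)) + (2 * l ∸ (length (chosen 1F) + length (chosen 2F)))

      budget : 2 * l < p → length slots + slack + l * (2 * l) ≤ l * (3 * p)
      budget 2l<p = subst (λ n → n + slack + l * (2 * l) ≤ l * (3 * p)) (sym length-slots)
        (slot-count 2l<p length-chosen₀+unchosen₀ (S≤l 0F)
          (subst (length (chosen 1F) + length (chosen 2F) ≤_) (sym (2*l≡l+l l)) (+-mono-≤ (S≤l 1F) (S≤l 2F))))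

    sparse-bound : 2 * l < p → length xs + l * (2 * l) < l * (3 * p)
    sparse-bound 2l<p with slack ≟ 0
    ... | no slack≢0 = begin-strict
      length xs + l * (2 * l)              ≤⟨ +-monoˡ-≤ (l * (2 * l)) (marked≤slots xs-unique xs-marked) ⟩
      length slots + l * (2 * l)           <⟨ +-monoˡ-< (l * (2 * l)) (m<m+n (length slots) (n≢0⇒n>0 slack≢0)) ⟩
      length slots + slack + l * (2 * l)   ≤⟨ budget 2l<p ⟩
      l * (3 * p)                          ∎
      where open Data.Nat.Properties.≤-Reasoning
    ... | yes slack≡0 =
      let l<p = ≤-<-trans (subst (l ≤_) (sym (2*l≡l+l l)) (m≤m+n l l)) 2l<p
          l≤s₀ = m∸n≡0⇒m≤n (m+n≡0⇒m≡0 _ slack≡0)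
          l≤s₁ , l≤s₂ = both-tight (S≤l 1F) (S≤l 2F) (m∸n≡0⇒m≤n (m+n≡0⇒n≡0 _ slack≡0))
          Q , Q-grid , Q-exceptional = exceptional-point (≤-trans (S≤l 0F) l≤s₁) (≤-trans (<⇒≤ 2≤l) l≤s₀)
                                         (≤-trans 2≤l l≤s₂) (≤-<-trans (S≤l 0F) l<p)
      in begin-strict
      length xs + l * (2 * l)              <⟨ +-monoˡ-< (l * (2 * l)) (marked<slots xs-unique xs-marked Q-grid Q-exceptional) ⟩
      length slots + l * (2 * l)           ≤⟨ +-monoˡ-≤ (l * (2 * l)) (m≤m+n (length slots) slack) ⟩
      length slots + slack + l * (2 * l)   ≤⟨ budget 2l<p ⟩
      l * (3 * p)                          ∎
      where open Data.Nat.Properties.≤-Reasoning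

    marked-bound : l < p → length xs + l * (2 * l) < l * (3 * p)
    marked-bound l<p with <-cmp (2 * l) p
    ... | tri< 2l<p _ _ = sparse-bound 2l<p
    ... | tri≈ _ 2l≡p _ = ⊥-elim (prime≢2*l p-prime 2≤l 2l≡p)
    ... | tri> _ _ p<2l = ≤-<-trans
      (+-monoˡ-≤ (l * (2 * l)) (unique-onGrid⇒length≤p*p xs-unique (All.map proj₁ xs-marked)))
      (grid-count l<p p<2l)

module CharacterCoordinates (p n : ℕ) .{{_ : NonZero p}} .{{_ : NonZero n}} (1<p : 1 < p) where

  open import Data.Nat as ℕ using (zero; suc; _+_)
  open import Data.Nat.Properties using (*-identityʳ; *-identityˡ; +-identityʳ; +-comm; <-≤-trans; <⇒≤; m≤m*n)
  open import Data.Nat.Tactic.RingSolver using (solve-∀)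
  open import Data.Nat.DivMod
    using (_%_; _/_; _mod_; m%n<n; m<n⇒m%n≡m; m%[n*o]/o≡m/o%n; +-distrib-/-∣ʳ; m*n/n≡m; m<n*o⇒m/o<n; m≡m%n+[m/n]*n;
           %-distribˡ-+; %-distribˡ-*; m%n%n≡m%n; [m+kn]%n≡m%n; m∣n⇒o%n%m≡o%m)
  open import Data.Nat.Divisibility using (_∣_; divides; n∣m*n; n∣n; _∣0; ∣m∣n⇒∣m+n; %-presˡ-∣)
  open import Data.Fin using (toℕ)
  open import Data.Fin.Properties using (toℕ-fromℕ<; toℕ<n; toℕ-injective)
  open import Data.Product using (_,_; proj₁; proj₂)
  open import Relation.Binary.PropositionalEquality
  open Grp p n

  toℕ-mod : ∀ m d .{{_ : NonZero d}} → toℕ (m mod d) ≡ m % d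
  toℕ-mod m d = toℕ-fromℕ< (m%n<n m d)

  1<p*n : 1 < p * n
  1<p*n = <-≤-trans 1<p (m≤m*n p n)

  0<p*n : 0 < p * n
  0<p*n = <⇒≤ 1<p*n

  toℕ-0mod : toℕ (0 mod (p * n)) ≡ 0
  toℕ-0mod = trans (toℕ-mod 0 (p * n)) (m<n⇒m%n≡m 0<p*n)

  ev-ke₁+e₂ : ∀ θ k → toℕ (ev θ (ke₁+e₂ k)) ≡ (n * toℕ (proj₁ θ) * toℕ k + toℕ (proj₂ θ)) % (p * n)
  ev-ke₁+e₂ (a , b) k = begin
    toℕ (ev (a , b) (ke₁+e₂ k))
      ≡⟨ toℕ-mod _ (p * n) ⟩
    (n * toℕ a * toℕ (toℕ k mod p) + toℕ b * toℕ (1 mod (p * n))) % (p * n)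
      ≡⟨ cong₂ (λ x y → (n * toℕ a * x + toℕ b * y) % (p * n))
               (trans (toℕ-mod (toℕ k) p) (m<n⇒m%n≡m (toℕ<n k)))
               (trans (toℕ-mod 1 (p * n)) (m<n⇒m%n≡m 1<p*n)) ⟩
    (n * toℕ a * toℕ k + toℕ b * 1) % (p * n)
      ≡⟨ cong (λ y → (n * toℕ a * toℕ k + y) % (p * n)) (*-identityʳ (toℕ b)) ⟩
    (n * toℕ a * toℕ k + toℕ b) % (p * n)
      ∎
    where open ≡-Reasoning

  -- θ = (a , b) takes the value ζ^(n a k + b) at k e₁ + e₂, so for c = b / n the exponent divided by n
  -- is c + k a (mod p).
  ev-ke₁+e₂/n : ∀ θ k → toℕ (ev θ (ke₁+e₂ k)) / n ≡ (toℕ (proj₂ θ) / n + toℕ k * toℕ (proj₁ θ)) % p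
  ev-ke₁+e₂/n θ@(a , b) k = begin
    toℕ (ev θ (ke₁+e₂ k)) / n                             ≡⟨ cong (_/ n) (ev-ke₁+e₂ θ k) ⟩
    (n * toℕ a * toℕ k + toℕ b) % (p * n) / n              ≡⟨ m%[n*o]/o≡m/o%n _ p n ⟩
    (n * toℕ a * toℕ k + toℕ b) / n % p                    ≡⟨ cong (λ x → x / n % p) (+-comm (n * toℕ a * toℕ k) (toℕ b)) ⟩
    (toℕ b + n * toℕ a * toℕ k) / n % p                    ≡⟨ cong (_% p) (+-distrib-/-∣ʳ (toℕ b) n∣nak) ⟩
    (toℕ b / n + n * toℕ a * toℕ k / n) % p                ≡⟨ cong (λ x → (toℕ b / n + x) % p) nak/n ⟩
    (toℕ b / n + toℕ k * toℕ a) % p                        ∎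
    where
    open ≡-Reasoning
    reorder : ∀ n a k → n * a * k ≡ k * a * n
    reorder = solve-∀
    nak≡ : n * toℕ a * toℕ k ≡ toℕ k * toℕ a * n
    nak≡ = reorder n (toℕ a) (toℕ k)
    n∣nak : n ∣ n * toℕ a * toℕ k
    n∣nak = subst (n ∣_) (sym nak≡) (n∣m*n (toℕ k * toℕ a))
    nak/n : n * toℕ a * toℕ k / n ≡ toℕ k * toℕ a
    nak/n = trans (cong (_/ n) nak≡) (m*n/n≡m (toℕ k * toℕ a) n)

  %-cong-+ : ∀ {x x′ y y′ M} .{{_ : NonZero M}} → x % M ≡ x′ % M → y % M ≡ y′ % M → (x + y) % M ≡ (x′ + y′) % M
  %-cong-+ {x} {x′} {y} {y′} {M} x≡x′ y≡y′ = begin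
    (x + y) % M              ≡⟨ %-distribˡ-+ x y M ⟩
    (x % M + y % M) % M      ≡⟨ cong₂ (λ u v → (u + v) % M) x≡x′ y≡y′ ⟩
    (x′ % M + y′ % M) % M    ≡⟨ %-distribˡ-+ x′ y′ M ⟨
    (x′ + y′) % M            ∎
    where open ≡-Reasoning

  %-congˡ-* : ∀ {x x′ M} .{{_ : NonZero M}} → x % M ≡ x′ % M → ∀ y → (x * y) % M ≡ (x′ * y) % M
  %-congˡ-* {x} {x′} {M} x≡x′ y = begin
    (x * y) % M              ≡⟨ %-distribˡ-* x y M ⟩
    (x % M * (y % M)) % M    ≡⟨ cong (λ u → (u * (y % M)) % M) x≡x′ ⟩
    (x′ % M * (y % M)) % M   ≡⟨ %-distribˡ-* x′ y M ⟨
    (x′ * y) % M             ∎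
    where open ≡-Reasoning

  n*[u%p]≡n*u : ∀ u → (n * (u % p)) % (p * n) ≡ (n * u) % (p * n)
  n*[u%p]≡n*u u = sym (begin
    (n * u) % (p * n)                                ≡⟨ cong (λ v → (n * v) % (p * n)) (m≡m%n+[m/n]*n u p) ⟩
    (n * (u % p + u / p * p)) % (p * n)               ≡⟨ cong (_% (p * n)) (expand n (u % p) (u / p) p) ⟩
    (n * (u % p) + u / p * (p * n)) % (p * n)         ≡⟨ [m+kn]%n≡m%n (n * (u % p)) (u / p) (p * n) ⟩
    (n * (u % p)) % (p * n)                          ∎)
    where
    open ≡-Reasoning
    expand : ∀ n r q p → n * (r + q * p) ≡ n * r + q * (p * n)
    expand = solve-∀

  ev-⊙ : ∀ χ χ′ g → toℕ (ev (χ ⊙ χ′) g) ≡ (toℕ (ev χ g) + toℕ (ev χ′ g)) % (p * n)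
  ev-⊙ (a , b) (a′ , b′) (x , y) = begin
    toℕ (ev ((a , b) ⊙ (a′ , b′)) (x , y))
      ≡⟨ toℕ-mod _ (p * n) ⟩
    (n * toℕ ((A + A′) mod p) * X + toℕ ((B + B′) mod (p * n)) * Y) % (p * n)
      ≡⟨ cong₂ (λ u v → (n * u * X + v * Y) % (p * n)) (toℕ-mod (A + A′) p) (toℕ-mod (B + B′) (p * n)) ⟩
    (n * ((A + A′) % p) * X + (B + B′) % (p * n) * Y) % (p * n)
      ≡⟨ %-cong-+ {M = p * n} (%-congˡ-* {M = p * n} (n*[u%p]≡n*u (A + A′)) X) (%-congˡ-* {M = p * n} (m%n%n≡m%n (B + B′) (p * n)) Y) ⟩
    (n * (A + A′) * X + (B + B′) * Y) % (p * n)
      ≡⟨ cong (_% (p * n)) (distribute n A A′ X B B′ Y) ⟩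
    ((n * A * X + B * Y) + (n * A′ * X + B′ * Y)) % (p * n)
      ≡⟨ %-distribˡ-+ (n * A * X + B * Y) _ (p * n) ⟩
    ((n * A * X + B * Y) % (p * n) + (n * A′ * X + B′ * Y) % (p * n)) % (p * n)
      ≡⟨ cong₂ (λ u v → (u + v) % (p * n)) (toℕ-mod _ (p * n)) (toℕ-mod _ (p * n)) ⟨
    (toℕ (ev (a , b) (x , y)) + toℕ (ev (a′ , b′) (x , y))) % (p * n)
      ∎
    where
    open ≡-Reasoning
    A A′ B B′ X Y : ℕ
    A = toℕ a
    A′ = toℕ a′
    B = toℕ b
    B′ = toℕ b′
    X = toℕ x
    Y = toℕ y
    distribute : ∀ n A A′ X B B′ Y → n * (A + A′) * X + (B + B′) * Y ≡ (n * A * X + B * Y) + (n * A′ * X + B′ * Y)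
    distribute = solve-∀

  1·G≡ : ∀ g → 1 ·G g ≡ g
  1·G≡ (x , y) = cong₂ _,_
    (toℕ-injective (trans (toℕ-mod _ p) (trans (cong (_% p) (*-identityˡ (toℕ x))) (m<n⇒m%n≡m (toℕ<n x)))))
    (toℕ-injective (trans (toℕ-mod _ (p * n)) (trans (cong (_% (p * n)) (*-identityˡ (toℕ y))) (m<n⇒m%n≡m (toℕ<n y)))))

  ev-coset-⊥ : ∀ {χ θ u} → coset χ (⟨ u ⟩ ⊥) θ → ev θ u ≡ ev χ u
  ev-coset-⊥ {χ} {u = u} (h , h⊥u , refl) = toℕ-injective (begin
    toℕ (ev (χ ⊙ h) u)                       ≡⟨ ev-⊙ χ h u ⟩
    (toℕ (ev χ u) + toℕ (ev h u)) % (p * n)   ≡⟨ cong (λ v → (toℕ (ev χ u) + v) % (p * n)) ev-h-u≡0 ⟩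
    (toℕ (ev χ u) + 0) % (p * n)              ≡⟨ cong (_% (p * n)) (+-identityʳ (toℕ (ev χ u))) ⟩
    toℕ (ev χ u) % (p * n)                    ≡⟨ m<n⇒m%n≡m (toℕ<n (ev χ u)) ⟩
    toℕ (ev χ u)                              ∎)
    where
    open ≡-Reasoning
    ev-h-u≡0 : toℕ (ev h u) ≡ 0
    ev-h-u≡0 = trans (cong toℕ (h⊥u u (1 , sym (1·G≡ u)))) toℕ-0mod

  second : Ĝ → ℕ
  second θ = toℕ (proj₂ θ)

  n∣p*n : n ∣ p * n
  n∣p*n = n∣m*n p

  n∣second-⊙ : ∀ {χ χ′} → n ∣ second χ → n ∣ second χ′ → n ∣ second (χ ⊙ χ′)
  n∣second-⊙ {χ} {χ′} n∣b n∣b′ =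
    subst (n ∣_) (sym (toℕ-mod _ (p * n))) (%-presˡ-∣ (∣m∣n⇒∣m+n n∣b n∣b′) n∣p*n)

  n∣second-𝟙 : n ∣ second 𝟙
  n∣second-𝟙 = subst (n ∣_) (sym (toℕ-mod 0 (p * n))) (%-presˡ-∣ (n ∣0) n∣p*n)

  n∣second-^ : ∀ {χ} → n ∣ second χ → ∀ t → n ∣ second (χ ^ t)
  n∣second-^ n∣b zero    = n∣second-𝟙
  n∣second-^ {χ} n∣b (suc t) = n∣second-⊙ {χ} {χ ^ t} n∣b (n∣second-^ n∣b t)

  second-φ^ : ∀ m → second (φ ^ m) ≡ m % (p * n)
  second-φ^ zero    = trans toℕ-0mod (sym (m<n⇒m%n≡m 0<p*n))
  second-φ^ (suc m) = begin
    second (φ ⊙ (φ ^ m))                              ≡⟨ toℕ-mod _ (p * n) ⟩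
    (toℕ (1 mod (p * n)) + second (φ ^ m)) % (p * n)   ≡⟨ cong₂ (λ u v → (u + v) % (p * n)) (toℕ-mod 1 (p * n)) (second-φ^ m) ⟩
    (1 % (p * n) + m % (p * n)) % (p * n)              ≡⟨ %-distribˡ-+ 1 m (p * n) ⟨
    suc m % (p * n)                                    ∎
    where open ≡-Reasoning

  n∣second-⟨ψ,φⁿ⟩ : ∀ {h} → ⟨ψ,φⁿ⟩ h → n ∣ second h
  n∣second-⟨ψ,φⁿ⟩ (s , t , refl) = n∣second-⊙ {ψ ^ s} {(φ ^ n) ^ t} (n∣second-^ {ψ} n∣second-𝟙 s)
    (n∣second-^ (subst (n ∣_) (sym (second-φ^ n)) (%-presˡ-∣ n∣n n∣p*n)) t)

  second%n-coset : ∀ {χ θ} → coset χ ⟨ψ,φⁿ⟩ θ → second θ % n ≡ second χ % n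
  second%n-coset {χ} (h , h∈ , refl) with divides q eq ← n∣second-⟨ψ,φⁿ⟩ h∈ = begin
    second (χ ⊙ h) % n                           ≡⟨ cong (_% n) (toℕ-mod _ (p * n)) ⟩
    (second χ + second h) % (p * n) % n          ≡⟨ m∣n⇒o%n%m≡o%m n (p * n) _ n∣p*n ⟩
    (second χ + second h) % n                    ≡⟨ cong (λ v → (second χ + v) % n) eq ⟩
    (second χ + q * n) % n                       ≡⟨ [m+kn]%n≡m%n (second χ) q n ⟩
    second χ % n                                 ∎
    where open ≡-Reasoning

  coordinates : Ĝ → ℕ × ℕ
  coordinates (a , b) = toℕ a , toℕ b / n

  coordinates<p : ∀ θ → proj₁ (coordinates θ) < p × proj₂ (coordinates θ) < p
  coordinates<p (a , b) = toℕ<n a , m<n*o⇒m/o<n (toℕ<n b)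

  coordinates-injective : ∀ {χ θ θ′} → coset χ ⟨ψ,φⁿ⟩ θ → coset χ ⟨ψ,φⁿ⟩ θ′ →
    coordinates θ ≡ coordinates θ′ → θ ≡ θ′
  coordinates-injective {χ} {θ@(a , b)} {θ′@(a′ , b′)} θ∈ θ′∈ eq =
    cong₂ _,_ (toℕ-injective (cong proj₁ eq)) (toℕ-injective (begin
      toℕ b                        ≡⟨ m≡m%n+[m/n]*n (toℕ b) n ⟩
      toℕ b % n + toℕ b / n * n     ≡⟨ cong₂ (λ r q → r + q * n) (trans (second%n-coset θ∈) (sym (second%n-coset θ′∈))) (cong proj₂ eq) ⟩
      toℕ b′ % n + toℕ b′ / n * n   ≡⟨ m≡m%n+[m/n]*n (toℕ b′) n ⟨
      toℕ b′                       ∎))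
    where open ≡-Reasoning

open Counting using (map-unique)
open Arithmetic using (m≤n∸1⇒m<n; m+k*n<k*o⇒m<k*[o∸n])

lemma3p9 : (p n : ℕ) .{{_ : NonZero p}} .{{_ : NonZero n}} → Prime p → 5 ≤ p →
    let open Grp p n in
    (k : Fin 3 → Fin p) → Injective _≡_ _≡_ k →
    (l : ℕ) → 2 ≤ l → l ≤ p ∸ 1 →
    (χ : Ĝ) → (χs : Fin 3 → Fin l → Ĝ) →
    (xs : List Ĝ) → Unique xs →
    All (λ θ → (∃[ i ] ∃[ j ] coset (χs i j) (⟨ ke₁+e₂ (k i) ⟩ ⊥) θ) × coset χ ⟨ψ,φⁿ⟩ θ) xs →
    length xs < l * (3 * p ∸ 2 * l)
lemma3p9 p n p-prime 5≤p k k-injective l 2≤l l≤p∸1 χ χs xs xs-unique xs-in =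
  subst (_< l * (3 * p ∸ 2 * l)) (length-map coordinates xs)
    (m+k*n<k*o⇒m<k*[o∸n] _ l (2 * l) (3 * p)
      (marked-bound 2≤l V≤l coordinates-unique coordinates-marked (m≤n∸1⇒m<n l≤p∸1)))
  where
  open Grp p n
  1<p : 1 < p
  1<p = ≤-trans (s≤s (s≤s z≤n)) 5≤p
  open CharacterCoordinates p n 1<p
  V : Fin 3 → List ℕ
  V i = tabulate (λ j → toℕ (ev (χs i j) (ke₁+e₂ (k i))) / n)
  open ThreeParallelClasses p p-prime k k-injective V
  V≤l : ∀ i → length (V i) ≤ l
  V≤l i = ≤-reflexive (length-tabulate _)
  coordinates-unique : Unique (map coordinates xs)
  coordinates-unique = map-unique coordinates coordinates-injective (All.map proj₂ xs-in) xs-unique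
  marked : ∀ {θ} → (∃[ i ] ∃[ j ] coset (χs i j) (⟨ ke₁+e₂ (k i) ⟩ ⊥) θ) × coset χ ⟨ψ,φⁿ⟩ θ → Marked (coordinates θ)
  marked {θ} ((i , j , θ∈) , _) = coordinates<p θ , i ,
    subst (_∈ V i) (trans (cong (λ v → toℕ v / n) (sym (ev-coset-⊥ θ∈))) (ev-ke₁+e₂/n θ (k i))) (∈-tabulate⁺ j)
  coordinates-marked : All Marked (map coordinates xs)
  coordinates-marked = map⁺ (All.map marked xs-in)
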